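{- Let $\gamma\in(0,1)$, let $U\in\mathbb{R}^{n\times d}$ have orthonormal columns, and let $S$ be a CountSketch matrix in $\mathcal{E}(\gamma)$, with $M=U^TS^TSU$. Then $\mathrm{Tr}((I-M)^k)\leq\gamma^{k-2}\|I-M\|_F^2$ for all integers $k\geq 2$.
   Context: A CountSketch matrix $S\in\mathbb{R}^{B\times n}$ is a matrix in which every column has exactly one nonzero entry, equal to $\pm1$. For $\gamma\in(0,1)$, $\mathcal{E}(\gamma)$ is the set of CountSketch matrices $S$ with $\|I-M\|_F^2\leq\gamma^2$ and $|\mathrm{Tr}(I-M)|\leq\gamma$, where $M=U^TS^TSU$. -}

module Defs where

open import Level using (Level; _⊔_) renaming (suc to lsuc)
open import Data.Nat using (ℕ; zero; suc)
open import Data.Fin using (Fin; zero; suc)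
open import Data.Product using (Σ; ∃; _×_; _,_)
open import Data.Sum using (_⊎_)
open import Relation.Nullary using (¬_)
open import Relation.Binary.PropositionalEquality using (_≢_)
open import Relation.Binary.Structures using (IsTotalOrder)
open import Algebra.Bundles using (CommutativeRing)

-- An ordered field (the reals are the intended instance).
record OrderedField (c ℓ₁ ℓ₂ : Level) : Set (lsuc (c ⊔ ℓ₁ ⊔ ℓ₂)) where
  field
    commutativeRing : CommutativeRing c ℓ₁
  open CommutativeRing commutativeRing public
  field
    _≤_          : Carrier → Carrier → Set ℓ₂
    isTotalOrder : IsTotalOrder _≈_ _≤_
    0≉1          : ¬ (0# ≈ 1#)
    inverse      : ∀ x → ¬ (x ≈ 0#) → Σ Carrier (λ y → (x * y) ≈ 1#)
    +-mono-≤     : ∀ {x y} z → x ≤ y → (x + z) ≤ (y + z)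
    *-nonneg     : ∀ {x y} → 0# ≤ x → 0# ≤ y → 0# ≤ (x * y)

module Matrices {c ℓ₁ ℓ₂} (F : OrderedField c ℓ₁ ℓ₂) where
  open OrderedField F hiding (zero)

  _<_ : Carrier → Carrier → Set (ℓ₁ ⊔ ℓ₂)
  x < y = (x ≤ y) × ¬ (x ≈ y)

  _^_ : Carrier → ℕ → Carrier
  x ^ zero  = 1#
  x ^ suc k = x * (x ^ k)

  Mat : ℕ → ℕ → Set c
  Mat m n = Fin m → Fin n → Carrier

  Σ[<_]_ : (n : ℕ) → (Fin n → Carrier) → Carrier
  Σ[< zero ] f = 0#
  Σ[< suc n ] f = f zero + Σ[< n ] (λ i → f (suc i))

  transpose : ∀ {m n} → Mat m n → Mat n m
  transpose A i j = A j i

  _·_ : ∀ {m n p} → Mat m n → Mat n p → Mat m p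
  _·_ {n = n} A B i j = Σ[< n ] (λ l → A i l * B l j)

  δ : ∀ {n} → Fin n → Fin n → Carrier
  δ zero    zero    = 1#
  δ zero    (suc j) = 0#
  δ (suc i) zero    = 0#
  δ (suc i) (suc j) = δ i j

  I : ∀ {n} → Mat n n
  I = δ

  _⊖_ : ∀ {m n} → Mat m n → Mat m n → Mat m n
  (A ⊖ B) i j = A i j - B i j

  _≈ᴹ_ : ∀ {m n} → Mat m n → Mat m n → Set ℓ₁
  A ≈ᴹ B = ∀ i j → A i j ≈ B i j

  _^ᴹ_ : ∀ {n} → Mat n n → ℕ → Mat n n
  A ^ᴹ zero  = I
  A ^ᴹ suc k = A · (A ^ᴹ k)

  Tr : ∀ {n} → Mat n n → Carrier
  Tr {n} A = Σ[< n ] (λ i → A i i)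

  ‖_‖F² : ∀ {m n} → Mat m n → Carrier
  ‖_‖F² {m} {n} A = Σ[< m ] (λ i → Σ[< n ] (λ j → A i j * A i j))

  AbsLe : Carrier → Carrier → Set ℓ₂
  AbsLe x y = ((- y) ≤ x) × (x ≤ y)

  OrthonormalColumns : ∀ {n d} → Mat n d → Set ℓ₁
  OrthonormalColumns U = (transpose U · U) ≈ᴹ I

  CountSketch : ∀ {B n} → Mat B n → Set ℓ₁
  CountSketch {B} {n} S =
    ∀ (j : Fin n) → Σ (Fin B) λ i →
      ((S i j ≈ 1#) ⊎ (S i j ≈ (- 1#))) × (∀ i′ → i′ ≢ i → S i′ j ≈ 0#)

  sketchGram : ∀ {B n d} → Mat n d → Mat B n → Mat d d
  sketchGram U S = (transpose U · transpose S) · (S · U)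

  InE : ∀ {B n d} → Carrier → Mat n d → Mat B n → Set (ℓ₁ ⊔ ℓ₂)
  InE γ U S = CountSketch S
            × (‖ I ⊖ sketchGram U S ‖F² ≤ (γ * γ))
            × AbsLe (Tr (I ⊖ sketchGram U S)) γ

-- Write A = I − M. It is symmetric and ‖A‖F² ≤ γ², so by Cauchy–Schwarz
-- ‖A X‖F² ≤ γ² ‖X‖F² for every X, and expanding 0 ≤ ‖γ X − A X‖F² gives
-- ⟪X, A X⟫ ≤ γ ‖X‖F². Since A is self-adjoint, ⟪X, A²⁺ʲ X⟫ = ⟪A X, Aʲ (A X)⟫,
-- so induction in steps of two yields ⟪X, Aʲ X⟫ ≤ γʲ ‖X‖F², and X = A turns this
-- into Tr A²⁺ʲ ≤ γʲ ‖A‖F². The argument works over any ordered field.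
module Submission where

open import Defs
open import Level using (Level; 0ℓ)
open import Algebra.Bundles using (RawRing; CommutativeRing)
open import Data.Nat as ℕ using (ℕ; zero; suc; _∸_; s≤s; z≤n) renaming (_≤_ to _≤ℕ_)
open import Data.Fin using (Fin; zero; suc)
open import Data.Product using (_×_; _,_; proj₁; proj₂)
open import Data.Sum using (inj₁; inj₂)
open import Data.Maybe using (Maybe; just; nothing)
open import Relation.Nullary using (yes; no)
open import Relation.Binary.PropositionalEquality as ≡ using (_≡_)
open import Relation.Binary.Bundles using (Poset)
import Relation.Binary.Reasoning.Setoid
import Relation.Binary.Reasoning.PartialOrder
open import Relation.Binary.Structures using (IsTotalOrder)
open import Algebra.Solver.Ring.AlmostCommutativeRing
  using (fromCommutativeRing; _-Raw-AlmostCommutative⟶_)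

-- Integers as differences a − b of naturals, normalised so that one side is zero;
-- normalisation makes the coefficients canonical, which the solver needs to
-- recognise cancellations.
module IntegerCoefficientSolver {c ℓ} (R : CommutativeRing c ℓ) where
  open CommutativeRing R
  open import Algebra.Properties.Semiring.Mult semiring
    using (×-homo-+; ×1-homo-*) renaming (_×_ to _×ᴿ_)
  open import Algebra.Properties.Ring ring
    using (-‿distribˡ-*; -‿distribʳ-*; -‿involutive; -0#≈0#; -‿+-comm)
  open import Algebra.Properties.CommutativeSemigroup +-commutativeSemigroup
    using (interchange)
  open import Relation.Binary.Reasoning.Setoid setoid

  Diff : Set
  Diff = ℕ × ℕ

  normalise : ℕ → ℕ → Diff
  normalise a b = a ∸ b , b ∸ a

  ℤ-rawRing : RawRing 0ℓ 0ℓ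
  ℤ-rawRing = record
    { Carrier = Diff
    ; _≈_     = _≡_
    ; _+_     = λ { (a , b) (c , d) → normalise (a ℕ.+ c) (b ℕ.+ d) }
    ; _*_     = λ { (a , b) (c , d) →
                    normalise (a ℕ.* c ℕ.+ b ℕ.* d) (a ℕ.* d ℕ.+ b ℕ.* c) }
    ; -_      = λ { (a , b) → b , a }
    ; 0#      = 0 , 0
    ; 1#      = 1 , 0
    }

  ι : ℕ → Carrier
  ι n = n ×ᴿ 1#

  ⟦_⟧ : Diff → Carrier
  ⟦ a , b ⟧ = ι a - ι b

  ⟦normalise⟧ : ∀ a b → ⟦ normalise a b ⟧ ≈ ⟦ a , b ⟧
  ⟦normalise⟧ zero    zero    = refl
  ⟦normalise⟧ zero    (suc b) = refl
  ⟦normalise⟧ (suc a) zero    = refl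
  ⟦normalise⟧ (suc a) (suc b) = begin
    ⟦ normalise a b ⟧                ≈⟨ ⟦normalise⟧ a b ⟩
    ι a - ι b                        ≈⟨ +-identityˡ _ ⟨
    0# + (ι a - ι b)                 ≈⟨ +-congʳ (-‿inverseʳ 1#) ⟨
    (1# - 1#) + (ι a - ι b)          ≈⟨ interchange _ _ _ _ ⟩
    (1# + ι a) + (- 1# + - ι b)      ≈⟨ +-congˡ (-‿+-comm _ _) ⟩
    (1# + ι a) - (1# + ι b)          ∎

  ⟦+⟧ : ∀ a b c d → ⟦ a ℕ.+ c , b ℕ.+ d ⟧ ≈ ⟦ a , b ⟧ + ⟦ c , d ⟧
  ⟦+⟧ a b c d = begin
    ι (a ℕ.+ c) - ι (b ℕ.+ d)    ≈⟨ +-cong (×-homo-+ 1# a c) (-‿cong (×-homo-+ 1# b d)) ⟩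
    (ι a + ι c) - (ι b + ι d)    ≈⟨ +-congˡ (-‿+-comm _ _) ⟨
    (ι a + ι c) + (- ι b + - ι d) ≈⟨ interchange _ _ _ _ ⟩
    (ι a - ι b) + (ι c - ι d)    ∎

  ⟦*⟧ : ∀ a b c d →
        ⟦ a ℕ.* c ℕ.+ b ℕ.* d , a ℕ.* d ℕ.+ b ℕ.* c ⟧ ≈ ⟦ a , b ⟧ * ⟦ c , d ⟧
  ⟦*⟧ a b c d = begin
    ⟦ a ℕ.* c ℕ.+ b ℕ.* d , a ℕ.* d ℕ.+ b ℕ.* c ⟧
      ≈⟨ ⟦+⟧ (a ℕ.* c) (a ℕ.* d) (b ℕ.* d) (b ℕ.* c) ⟩
    (ι (a ℕ.* c) - ι (a ℕ.* d)) + (ι (b ℕ.* d) - ι (b ℕ.* c))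
      ≈⟨ +-cong (+-cong (×1-homo-* a c) (-‿cong (×1-homo-* a d)))
                (+-cong (×1-homo-* b d) (-‿cong (×1-homo-* b c))) ⟩
    (A * C - A * D) + (B * D - B * C)
      ≈⟨ +-cong (+-congˡ (-‿distribʳ-* A D)) (+-comm _ _) ⟩
    (A * C + A * - D) + (- (B * C) + B * D)
      ≈⟨ +-congˡ (+-cong (-‿distribˡ-* B C) minus-minus) ⟩
    (A * C + A * - D) + (- B * C + - B * - D)
      ≈⟨ +-cong (distribˡ A C (- D)) (distribˡ (- B) C (- D)) ⟨
    A * (C - D) + - B * (C - D)
      ≈⟨ distribʳ _ _ _ ⟨
    (A - B) * (C - D) ∎
    where
    A = ι a ; B = ι b ; C = ι c ; D = ι d
    minus-minus : B * D ≈ - B * - D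
    minus-minus = begin
      B * D         ≈⟨ -‿involutive _ ⟨
      - - (B * D)   ≈⟨ -‿cong (-‿distribˡ-* B D) ⟩
      - (- B * D)   ≈⟨ -‿distribʳ-* (- B) D ⟩
      - B * - D     ∎

  ⟦⟧-homomorphism : ℤ-rawRing -Raw-AlmostCommutative⟶ fromCommutativeRing R
  ⟦⟧-homomorphism = record
    { ⟦_⟧    = ⟦_⟧
    ; +-homo = λ { (a , b) (c , d) →
        trans (⟦normalise⟧ (a ℕ.+ c) (b ℕ.+ d)) (⟦+⟧ a b c d) }
    ; *-homo = λ { (a , b) (c , d) →
        trans (⟦normalise⟧ (a ℕ.* c ℕ.+ b ℕ.* d) (a ℕ.* d ℕ.+ b ℕ.* c)) (⟦*⟧ a b c d) }
    ; -‿homo = λ { (a , b) →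
        trans (+-comm _ _) (trans (+-congˡ (sym (-‿involutive _))) (-‿+-comm _ _)) }
    ; 0-homo = -‿inverseʳ 0#
    ; 1-homo = trans (+-cong (+-identityʳ 1#) -0#≈0#) (+-identityʳ 1#)
    }

  ⟦⟧-≟ : ∀ x y → Maybe (⟦ x ⟧ ≈ ⟦ y ⟧)
  ⟦⟧-≟ (a , b) (c , d) with a ℕ.≟ c | b ℕ.≟ d
  ... | yes ≡.refl | yes ≡.refl = just refl
  ... | _          | _          = nothing

  open import Algebra.Solver.Ring ℤ-rawRing (fromCommutativeRing R) ⟦⟧-homomorphism ⟦⟧-≟
    public using (solve; _:=_; _:+_; _:*_; _:-_; :-_)

module Properties {c ℓ₁ ℓ₂} (F : OrderedField c ℓ₁ ℓ₂) where
  open OrderedField F hiding (zero; _≤_) renaming (+-mono-≤ to +-monoˡ-≤)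
  open Matrices F
  open IsTotalOrder isTotalOrder using (total)
    renaming (reflexive to ≤-reflexive; trans to ≤-trans; antisym to ≤-antisym)
  open IntegerCoefficientSolver commutativeRing

  -- The same relation as in Defs, given the usual fixity.
  infix 4 _≤_
  _≤_ : Carrier → Carrier → Set ℓ₂
  _≤_ = OrderedField._≤_ F

  module ≈-Reasoning = Relation.Binary.Reasoning.Setoid setoid

  poset : Poset c ℓ₁ ℓ₂
  poset = record { isPartialOrder = IsTotalOrder.isPartialOrder isTotalOrder }

  module ≤-Reasoning = Relation.Binary.Reasoning.PartialOrder poset

  ≤-respˡ-≈ : ∀ {x x′ y} → x ≈ x′ → x ≤ y → x′ ≤ y
  ≤-respˡ-≈ x≈x′ x≤y = ≤-trans (≤-reflexive (sym x≈x′)) x≤y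

  ≤-respʳ-≈ : ∀ {x y y′} → y ≈ y′ → x ≤ y → x ≤ y′
  ≤-respʳ-≈ y≈y′ x≤y = ≤-trans x≤y (≤-reflexive y≈y′)

  +-monoʳ-≤ : ∀ x {y z} → y ≤ z → x + y ≤ x + z
  +-monoʳ-≤ x {y} {z} y≤z = ≤-respˡ-≈ (+-comm y x) (≤-respʳ-≈ (+-comm z x) (+-monoˡ-≤ x y≤z))

  +-mono-≤ : ∀ {x y u v} → x ≤ y → u ≤ v → x + u ≤ y + v
  +-mono-≤ {y = y} {u} x≤y u≤v = ≤-trans (+-monoˡ-≤ u x≤y) (+-monoʳ-≤ y u≤v)

  x≤y⇒0≤y-x : ∀ {x y} → x ≤ y → 0# ≤ y - x
  x≤y⇒0≤y-x {x} x≤y = ≤-respˡ-≈ (-‿inverseʳ x) (+-monoˡ-≤ (- x) x≤y)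

  0≤y-x⇒x≤y : ∀ {x y} → 0# ≤ y - x → x ≤ y
  0≤y-x⇒x≤y {x} {y} 0≤y-x = begin
    x              ≈⟨ +-identityˡ x ⟨
    0# + x         ≤⟨ +-monoˡ-≤ x 0≤y-x ⟩
    (y - x) + x    ≈⟨ solve 2 (λ x y → (y :- x) :+ x := y) refl x y ⟩
    y              ∎
    where open ≤-Reasoning

  x≤0⇒0≤-x : ∀ {x} → x ≤ 0# → 0# ≤ - x
  x≤0⇒0≤-x x≤0 = ≤-respʳ-≈ (+-identityˡ _) (x≤y⇒0≤y-x x≤0)

  0≤x*x : ∀ x → 0# ≤ x * x
  0≤x*x x with total 0# x
  ... | inj₁ 0≤x = *-nonneg 0≤x 0≤x
  ... | inj₂ x≤0 = ≤-respʳ-≈ (solve 1 (λ x → (:- x) :* (:- x) := x :* x) refl x)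
                     (*-nonneg (x≤0⇒0≤-x x≤0) (x≤0⇒0≤-x x≤0))

  *-monoˡ-≤-nonNeg : ∀ {z x y} → 0# ≤ z → x ≤ y → z * x ≤ z * y
  *-monoˡ-≤-nonNeg {z} {x} {y} 0≤z x≤y = 0≤y-x⇒x≤y (≤-respʳ-≈
    (solve 3 (λ z x y → z :* (y :- x) := z :* y :- z :* x) refl z x y)
    (*-nonneg 0≤z (x≤y⇒0≤y-x x≤y)))

  *-monoʳ-≤-nonNeg : ∀ {z x y} → 0# ≤ z → x ≤ y → x * z ≤ y * z
  *-monoʳ-≤-nonNeg {z} {x} {y} 0≤z x≤y =
    ≤-respˡ-≈ (*-comm z x) (≤-respʳ-≈ (*-comm z y) (*-monoˡ-≤-nonNeg 0≤z x≤y))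

  0≤x+x⇒0≤x : ∀ {x} → 0# ≤ x + x → 0# ≤ x
  0≤x+x⇒0≤x {x} 0≤x+x with total 0# x
  ... | inj₁ 0≤x = 0≤x
  ... | inj₂ x≤0 = begin
    0#                  ≈⟨ +-identityˡ 0# ⟨
    0# + 0#             ≤⟨ +-mono-≤ 0≤x+x (x≤0⇒0≤-x x≤0) ⟩
    (x + x) + - x       ≈⟨ solve 1 (λ x → (x :+ x) :- x := x) refl x ⟩
    x                   ∎
    where open ≤-Reasoning

  0<x⇒0≤x*y⇒0≤y : ∀ {x y} → 0# < x → 0# ≤ x * y → 0# ≤ y
  0<x⇒0≤x*y⇒0≤y {x} {y} (0≤x , 0≉x) 0≤xy with total 0# y
  ... | inj₁ 0≤y = 0≤y
  ... | inj₂ y≤0 = ≤-reflexive (sym y≈0)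
    where
    open ≈-Reasoning
    xy≤0 : x * y ≤ 0#
    xy≤0 = 0≤y-x⇒x≤y (≤-respʳ-≈
      (trans (solve 2 (λ x y → x :* (:- y) := :- (x :* y)) refl x y) (sym (+-identityˡ _)))
      (*-nonneg 0≤x (x≤0⇒0≤-x y≤0)))
    x⁻¹ : Carrier
    x⁻¹ = proj₁ (inverse x (λ x≈0 → 0≉x (sym x≈0)))
    y≈0 : y ≈ 0#
    y≈0 = begin
      y                ≈⟨ *-identityˡ y ⟨
      1# * y           ≈⟨ *-congʳ (proj₂ (inverse x (λ x≈0 → 0≉x (sym x≈0)))) ⟨
      (x * x⁻¹) * y    ≈⟨ solve 3 (λ x x⁻¹ y → (x :* x⁻¹) :* y := x⁻¹ :* (x :* y)) refl x x⁻¹ y ⟩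
      x⁻¹ * (x * y)    ≈⟨ *-congˡ (≤-antisym xy≤0 0≤xy) ⟩
      x⁻¹ * 0#         ≈⟨ zeroʳ x⁻¹ ⟩
      0#               ∎

  ^-nonNeg : ∀ {x} → 0# ≤ x → ∀ n → 0# ≤ x ^ n
  ^-nonNeg 0≤x zero    = ≤-respʳ-≈ (*-identityˡ 1#) (0≤x*x 1#)
  ^-nonNeg 0≤x (suc n) = *-nonneg 0≤x (^-nonNeg 0≤x n)

  Σ-cong : ∀ {n} {f g : Fin n → Carrier} → (∀ i → f i ≈ g i) → Σ[< n ] f ≈ Σ[< n ] g
  Σ-cong {zero}  f≈g = refl
  Σ-cong {suc n} f≈g = +-cong (f≈g zero) (Σ-cong (λ i → f≈g (suc i)))

  Σ-0 : ∀ n → Σ[< n ] (λ _ → 0#) ≈ 0#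
  Σ-0 zero    = refl
  Σ-0 (suc n) = trans (+-congˡ (Σ-0 n)) (+-identityˡ 0#)

  Σ-+ : ∀ {n} (f g : Fin n → Carrier) →
        Σ[< n ] (λ i → f i + g i) ≈ Σ[< n ] f + Σ[< n ] g
  Σ-+ {zero}  f g = sym (+-identityˡ 0#)
  Σ-+ {suc n} f g = trans (+-congˡ (Σ-+ (λ i → f (suc i)) (λ i → g (suc i))))
    (solve 4 (λ a b x y → (a :+ b) :+ (x :+ y) := (a :+ x) :+ (b :+ y)) refl
      (f zero) (g zero) (Σ[< n ] (λ i → f (suc i))) (Σ[< n ] (λ i → g (suc i))))

  Σ-neg : ∀ {n} (f : Fin n → Carrier) → Σ[< n ] (λ i → - f i) ≈ - Σ[< n ] f
  Σ-neg {zero}  f = trans (sym (-‿inverseʳ 0#)) (+-identityˡ _)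
  Σ-neg {suc n} f = trans (+-congˡ (Σ-neg (λ i → f (suc i))))
    (solve 2 (λ a b → (:- a) :+ (:- b) := :- (a :+ b)) refl (f zero) _)

  Σ-*ˡ : ∀ {n} (k : Carrier) (f : Fin n → Carrier) →
         Σ[< n ] (λ i → k * f i) ≈ k * Σ[< n ] f
  Σ-*ˡ {zero}  k f = sym (zeroʳ k)
  Σ-*ˡ {suc n} k f = trans (+-congˡ (Σ-*ˡ k (λ i → f (suc i)))) (sym (distribˡ k _ _))

  Σ-*ʳ : ∀ {n} (k : Carrier) (f : Fin n → Carrier) →
         Σ[< n ] (λ i → f i * k) ≈ Σ[< n ] f * k
  Σ-*ʳ k f = trans (Σ-cong (λ i → *-comm (f i) k)) (trans (Σ-*ˡ k f) (*-comm k _))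

  Σ-swap : ∀ {m n} (f : Fin m → Fin n → Carrier) →
    Σ[< m ] (λ i → Σ[< n ] (λ j → f i j)) ≈ Σ[< n ] (λ j → Σ[< m ] (λ i → f i j))
  Σ-swap {zero}  {n} f = sym (Σ-0 n)
  Σ-swap {suc m} {n} f = trans (+-congˡ (Σ-swap (λ i j → f (suc i) j)))
    (sym (Σ-+ (λ j → f zero j) (λ j → Σ[< m ] (λ i → f (suc i) j))))

  Σ-mono-≤ : ∀ {n} {f g : Fin n → Carrier} → (∀ i → f i ≤ g i) → Σ[< n ] f ≤ Σ[< n ] g
  Σ-mono-≤ {zero}  f≤g = ≤-reflexive refl
  Σ-mono-≤ {suc n} f≤g = +-mono-≤ (f≤g zero) (Σ-mono-≤ (λ i → f≤g (suc i)))

  ΣΣ : ∀ {m n} → (Fin m → Fin n → Carrier) → Carrier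
  ΣΣ {m} {n} f = Σ[< m ] (λ i → Σ[< n ] (λ j → f i j))

  ΣΣ-cong : ∀ {m n} {f g : Fin m → Fin n → Carrier} →
            (∀ i j → f i j ≈ g i j) → ΣΣ f ≈ ΣΣ g
  ΣΣ-cong f≈g = Σ-cong (λ i → Σ-cong (f≈g i))

  ΣΣ-mono-≤ : ∀ {m n} {f g : Fin m → Fin n → Carrier} →
              (∀ i j → f i j ≤ g i j) → ΣΣ f ≤ ΣΣ g
  ΣΣ-mono-≤ f≤g = Σ-mono-≤ (λ i → Σ-mono-≤ (f≤g i))

  ΣΣ-nonNeg : ∀ {m n} {f : Fin m → Fin n → Carrier} → (∀ i j → 0# ≤ f i j) → 0# ≤ ΣΣ f
  ΣΣ-nonNeg {m} {n} 0≤f =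
    ≤-respˡ-≈ (trans (Σ-cong {m} (λ _ → Σ-0 n)) (Σ-0 m)) (ΣΣ-mono-≤ 0≤f)

  ΣΣ-*ˡ : ∀ {m n} (k : Carrier) (f : Fin m → Fin n → Carrier) →
          ΣΣ (λ i j → k * f i j) ≈ k * ΣΣ f
  ΣΣ-*ˡ {m} {n} k f = trans (Σ-cong {m} (λ i → Σ-*ˡ {n} k (f i))) (Σ-*ˡ {m} k _)

  ΣΣ-separable : ∀ {m n} (f : Fin m → Carrier) (g : Fin n → Carrier) →
                 ΣΣ (λ i j → f i * g j) ≈ Σ[< m ] f * Σ[< n ] g
  ΣΣ-separable {m} f g = trans (Σ-cong {m} (λ i → Σ-*ˡ (f i) g)) (Σ-*ʳ _ f)

  ΣΣ-x+y-2z : ∀ {m n} (x y z : Fin m → Fin n → Carrier) →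
    ΣΣ (λ i j → (x i j + y i j) - (z i j + z i j)) ≈ (ΣΣ x + ΣΣ y) - (ΣΣ z + ΣΣ z)
  ΣΣ-x+y-2z {m} {n} x y z = begin
    ΣΣ (λ i j → (x i j + y i j) - (z i j + z i j))
      ≈⟨ Σ-cong {m} (λ i → Σ-+ {n} _ _) ⟩
    Σ[< m ] (λ i → Σ[< n ] (λ j → x i j + y i j) + Σ[< n ] (λ j → - (z i j + z i j)))
      ≈⟨ Σ-cong {m} (λ i → +-cong (Σ-+ (x i) (y i)) (trans (Σ-neg {n} _) (-‿cong (Σ-+ (z i) (z i))))) ⟩
    Σ[< m ] (λ i → (Σ[< n ] (x i) + Σ[< n ] (y i)) - (Σ[< n ] (z i) + Σ[< n ] (z i)))
      ≈⟨ trans (Σ-+ {m} _ _) (+-cong (Σ-+ {m} _ _) (trans (Σ-neg {m} _) (-‿cong (Σ-+ {m} _ _)))) ⟩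
    (ΣΣ x + ΣΣ y) - (ΣΣ z + ΣΣ z) ∎
    where open ≈-Reasoning

  cauchy-schwarz : ∀ {n} (a b : Fin n → Carrier) →
    let R = Σ[< n ] (λ l → a l * b l) in
    R * R ≤ Σ[< n ] (λ l → a l * a l) * Σ[< n ] (λ l → b l * b l)
  cauchy-schwarz {n} a b = 0≤y-x⇒x≤y (0≤x+x⇒0≤x (begin
    0#
      ≤⟨ ΣΣ-nonNeg {n} {n} (λ i j → 0≤x*x (a i * b j - a j * b i)) ⟩
    ΣΣ (λ i j → (a i * b j - a j * b i) * (a i * b j - a j * b i))
      ≈⟨ ΣΣ-cong {n} {n} (λ i j → solve 4 (λ ai aj bi bj →
           (ai :* bj :- aj :* bi) :* (ai :* bj :- aj :* bi)
           := ((ai :* ai) :* (bj :* bj) :+ (bi :* bi) :* (aj :* aj))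
              :- ((ai :* bi) :* (aj :* bj) :+ (ai :* bi) :* (aj :* bj)))
           refl (a i) (a j) (b i) (b j)) ⟩
    ΣΣ (λ i j → ((a i * a i) * (b j * b j) + (b i * b i) * (a j * a j))
                - ((a i * b i) * (a j * b j) + (a i * b i) * (a j * b j)))
      ≈⟨ ΣΣ-x+y-2z {n} {n} _ _ _ ⟩
    (ΣΣ (λ i j → (a i * a i) * (b j * b j)) + ΣΣ (λ i j → (b i * b i) * (a j * a j)))
      - (ΣΣ (λ i j → (a i * b i) * (a j * b j)) + ΣΣ (λ i j → (a i * b i) * (a j * b j)))
      ≈⟨ +-cong (+-cong (ΣΣ-separable {n} {n} _ _) (ΣΣ-separable {n} {n} _ _))
                (-‿cong (+-cong (ΣΣ-separable {n} {n} _ _) (ΣΣ-separable {n} {n} _ _))) ⟩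
    (P * Q + Q * P) - (R * R + R * R)
      ≈⟨ solve 3 (λ P Q R → (P :* Q :+ Q :* P) :- (R :* R :+ R :* R)
                            := (P :* Q :- R :* R) :+ (P :* Q :- R :* R)) refl P Q R ⟩
    (P * Q - R * R) + (P * Q - R * R) ∎))
    where
    open ≤-Reasoning
    P = Σ[< n ] (λ l → a l * a l)
    Q = Σ[< n ] (λ l → b l * b l)
    R = Σ[< n ] (λ l → a l * b l)

  ≈ᴹ-refl : ∀ {m n} {A : Mat m n} → A ≈ᴹ A
  ≈ᴹ-refl i j = refl

  ≈ᴹ-sym : ∀ {m n} {A B : Mat m n} → A ≈ᴹ B → B ≈ᴹ A
  ≈ᴹ-sym A≈B i j = sym (A≈B i j)

  ≈ᴹ-trans : ∀ {m n} {A B C : Mat m n} → A ≈ᴹ B → B ≈ᴹ C → A ≈ᴹ C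
  ≈ᴹ-trans A≈B B≈C i j = trans (A≈B i j) (B≈C i j)

  IsSymmetric : ∀ {n} → Mat n n → Set ℓ₁
  IsSymmetric A = transpose A ≈ᴹ A

  δ-sym : ∀ {n} → IsSymmetric (δ {n})
  δ-sym zero    zero    = refl
  δ-sym zero    (suc j) = refl
  δ-sym (suc i) zero    = refl
  δ-sym (suc i) (suc j) = δ-sym i j

  Σ-δ : ∀ {n} (i : Fin n) (x : Fin n → Carrier) → Σ[< n ] (λ l → δ i l * x l) ≈ x i
  Σ-δ {suc n} zero x = begin
    1# * x zero + Σ[< n ] (λ l → 0# * x (suc l))
      ≈⟨ +-cong (*-identityˡ _) (trans (Σ-cong {n} (λ l → zeroˡ _)) (Σ-0 n)) ⟩
    x zero + 0#    ≈⟨ +-identityʳ _ ⟩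
    x zero         ∎
    where open ≈-Reasoning
  Σ-δ {suc n} (suc i) x = begin
    0# * x zero + Σ[< n ] (λ l → δ i l * x (suc l))
      ≈⟨ +-cong (zeroˡ _) (Σ-δ i (λ l → x (suc l))) ⟩
    0# + x (suc i) ≈⟨ +-identityˡ _ ⟩
    x (suc i)      ∎
    where open ≈-Reasoning

  ·-identityˡ : ∀ {m n} (X : Mat m n) → (I · X) ≈ᴹ X
  ·-identityˡ X i j = Σ-δ i (λ l → X l j)

  ·-identityʳ : ∀ {m n} (X : Mat m n) → (X · I) ≈ᴹ X
  ·-identityʳ X i j =
    trans (Σ-cong (λ l → trans (*-comm _ _) (*-congʳ (δ-sym j l)))) (Σ-δ j (X i))

  ·-cong : ∀ {m n p} {A A′ : Mat m n} {B B′ : Mat n p} →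
           A ≈ᴹ A′ → B ≈ᴹ B′ → (A · B) ≈ᴹ (A′ · B′)
  ·-cong A≈A′ B≈B′ i j = Σ-cong (λ l → *-cong (A≈A′ i l) (B≈B′ l j))

  ·-assoc : ∀ {m n p q} (A : Mat m n) (B : Mat n p) (C : Mat p q) →
            ((A · B) · C) ≈ᴹ (A · (B · C))
  ·-assoc {n = n} {p} A B C i j = begin
    Σ[< p ] (λ k → Σ[< n ] (λ l → A i l * B l k) * C k j)
      ≈⟨ Σ-cong (λ k → Σ-*ʳ (C k j) (λ l → A i l * B l k)) ⟨
    Σ[< p ] (λ k → Σ[< n ] (λ l → (A i l * B l k) * C k j))
      ≈⟨ Σ-swap {p} {n} _ ⟩
    Σ[< n ] (λ l → Σ[< p ] (λ k → (A i l * B l k) * C k j))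
      ≈⟨ Σ-cong {n} (λ l → trans (Σ-cong {p} (λ k → *-assoc _ _ _)) (Σ-*ˡ {p} (A i l) _)) ⟩
    Σ[< n ] (λ l → A i l * Σ[< p ] (λ k → B l k * C k j)) ∎
    where open ≈-Reasoning

  transpose-· : ∀ {m n p} (A : Mat m n) (B : Mat n p) →
                (transpose B · transpose A) ≈ᴹ transpose (A · B)
  transpose-· {n = n} A B i j = Σ-cong {n} (λ l → *-comm _ _)

  gram-symmetric : ∀ {m n} (A : Mat m n) → IsSymmetric (transpose A · A)
  gram-symmetric A = ≈ᴹ-sym (transpose-· (transpose A) A)

  ^ᴹ-comm : ∀ {n} (A : Mat n n) k → (A · (A ^ᴹ k)) ≈ᴹ ((A ^ᴹ k) · A)
  ^ᴹ-comm A zero    = ≈ᴹ-trans (·-identityʳ A) (≈ᴹ-sym (·-identityˡ A))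
  ^ᴹ-comm A (suc k) =
    ≈ᴹ-trans (·-cong ≈ᴹ-refl (^ᴹ-comm A k)) (≈ᴹ-sym (·-assoc A (A ^ᴹ k) A))

  ^ᴹ-symmetric : ∀ {n} {A : Mat n n} → IsSymmetric A → ∀ k → IsSymmetric (A ^ᴹ k)
  ^ᴹ-symmetric A-sym zero    = δ-sym
  ^ᴹ-symmetric {A = A} A-sym (suc k) = ≈ᴹ-trans
    (≈ᴹ-trans (≈ᴹ-sym (transpose-· A (A ^ᴹ k))) (·-cong (^ᴹ-symmetric A-sym k) A-sym))
    (≈ᴹ-sym (^ᴹ-comm A k))

  symmetric-resp-≈ᴹ : ∀ {n} {A B : Mat n n} → A ≈ᴹ B → IsSymmetric A → IsSymmetric B
  symmetric-resp-≈ᴹ A≈B A-sym i j = trans (sym (A≈B j i)) (trans (A-sym i j) (A≈B i j))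

  ⊖-symmetric : ∀ {n} {A B : Mat n n} → IsSymmetric A → IsSymmetric B → IsSymmetric (A ⊖ B)
  ⊖-symmetric A-sym B-sym i j = +-cong (A-sym i j) (-‿cong (B-sym i j))

  sketchGram-symmetric : ∀ {B n d} (U : Mat n d) (S : Mat B n) → IsSymmetric (sketchGram U S)
  sketchGram-symmetric U S = symmetric-resp-≈ᴹ
    (·-cong (≈ᴹ-sym (transpose-· S U)) ≈ᴹ-refl) (gram-symmetric (S · U))

  ⟪_,_⟫ : ∀ {m n} → Mat m n → Mat m n → Carrier
  ⟪ X , Y ⟫ = ΣΣ (λ i j → X i j * Y i j)

  ⟪⟫-congʳ : ∀ {m n} (X : Mat m n) {Y Y′ : Mat m n} → Y ≈ᴹ Y′ → ⟪ X , Y ⟫ ≈ ⟪ X , Y′ ⟫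
  ⟪⟫-congʳ X Y≈Y′ = ΣΣ-cong (λ i j → *-congˡ (Y≈Y′ i j))

  ⟪⟫-congˡ : ∀ {m n} {X X′ : Mat m n} (Y : Mat m n) → X ≈ᴹ X′ → ⟪ X , Y ⟫ ≈ ⟪ X′ , Y ⟫
  ⟪⟫-congˡ Y X≈X′ = ΣΣ-cong (λ i j → *-congʳ (X≈X′ i j))

  Tr-· : ∀ {m n} (A : Mat m n) (B : Mat n m) → Tr (A · B) ≈ ⟪ A , transpose B ⟫
  Tr-· A B = refl

  ‖‖F²-nonNeg : ∀ {m n} (X : Mat m n) → 0# ≤ ‖ X ‖F²
  ‖‖F²-nonNeg X = ΣΣ-nonNeg (λ i j → 0≤x*x (X i j))

  ·-adjoint : ∀ {m n p} (A : Mat m n) (X : Mat m p) (Z : Mat n p) →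
              ⟪ X , A · Z ⟫ ≈ ⟪ transpose A · X , Z ⟫
  ·-adjoint {m} {n} {p} A X Z = begin
    Σ[< m ] (λ i → Σ[< p ] (λ j → X i j * Σ[< n ] (λ l → A i l * Z l j)))
      ≈⟨ Σ-cong {m} (λ i → Σ-cong {p} (λ j → Σ-*ˡ {n} (X i j) _)) ⟨
    Σ[< m ] (λ i → Σ[< p ] (λ j → Σ[< n ] (λ l → X i j * (A i l * Z l j))))
      ≈⟨ trans (Σ-cong {m} (λ i → Σ-swap {p} {n} _)) (Σ-swap {m} {n} _) ⟩
    Σ[< n ] (λ l → Σ[< m ] (λ i → Σ[< p ] (λ j → X i j * (A i l * Z l j))))
      ≈⟨ Σ-cong {n} (λ l → Σ-swap {m} {p} _) ⟩
    Σ[< n ] (λ l → Σ[< p ] (λ j → Σ[< m ] (λ i → X i j * (A i l * Z l j))))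
      ≈⟨ Σ-cong {n} (λ l → Σ-cong {p} (λ j → Σ-cong {m} (λ i →
           solve 3 (λ x a z → x :* (a :* z) := (a :* x) :* z) refl (X i j) (A i l) (Z l j)))) ⟩
    Σ[< n ] (λ l → Σ[< p ] (λ j → Σ[< m ] (λ i → (A i l * X i j) * Z l j)))
      ≈⟨ Σ-cong {n} (λ l → Σ-cong {p} (λ j → Σ-*ʳ {m} (Z l j) _)) ⟩
    Σ[< n ] (λ l → Σ[< p ] (λ j → Σ[< m ] (λ i → A i l * X i j) * Z l j)) ∎
    where open ≈-Reasoning

  ‖xX-Z‖F² : ∀ {m n} (x : Carrier) (X Z : Mat m n) →
    ‖ (λ i j → x * X i j - Z i j) ‖F²
      ≈ (x * (x * ‖ X ‖F²) + ‖ Z ‖F²) - (x * ⟪ X , Z ⟫ + x * ⟪ X , Z ⟫)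
  ‖xX-Z‖F² {m} {n} x X Z = begin
    ‖ (λ i j → x * X i j - Z i j) ‖F²
      ≈⟨ ΣΣ-cong {m} {n} (λ i j → solve 3 (λ x X Z →
           (x :* X :- Z) :* (x :* X :- Z)
           := (x :* (x :* (X :* X)) :+ Z :* Z) :- (x :* (X :* Z) :+ x :* (X :* Z)))
           refl x (X i j) (Z i j)) ⟩
    ΣΣ (λ i j → (x * (x * (X i j * X i j)) + Z i j * Z i j)
                - (x * (X i j * Z i j) + x * (X i j * Z i j)))
      ≈⟨ ΣΣ-x+y-2z {m} {n} _ _ _ ⟩
    (ΣΣ (λ i j → x * (x * (X i j * X i j))) + ‖ Z ‖F²)
      - (ΣΣ (λ i j → x * (X i j * Z i j)) + ΣΣ (λ i j → x * (X i j * Z i j)))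
      ≈⟨ +-cong (+-congʳ (trans (ΣΣ-*ˡ {m} {n} x _) (*-congˡ (ΣΣ-*ˡ {m} {n} x _))))
                (-‿cong (+-cong (ΣΣ-*ˡ {m} {n} x _) (ΣΣ-*ˡ {m} {n} x _))) ⟩
    (x * (x * ‖ X ‖F²) + ‖ Z ‖F²) - (x * ⟪ X , Z ⟫ + x * ⟪ X , Z ⟫) ∎
    where open ≈-Reasoning

  ‖‖F²-submultiplicative : ∀ {m n p} (A : Mat m n) (X : Mat n p) →
                           ‖ A · X ‖F² ≤ ‖ A ‖F² * ‖ X ‖F²
  ‖‖F²-submultiplicative {m} {n} {p} A X = begin
    ‖ A · X ‖F²
      ≤⟨ ΣΣ-mono-≤ {m} {p} (λ i j → cauchy-schwarz (A i) (λ l → X l j)) ⟩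
    ΣΣ (λ i j → Σ[< n ] (λ l → A i l * A i l) * Σ[< n ] (λ l → X l j * X l j))
      ≈⟨ ΣΣ-separable {m} {p} _ _ ⟩
    ‖ A ‖F² * Σ[< p ] (λ j → Σ[< n ] (λ l → X l j * X l j))
      ≈⟨ *-congˡ (Σ-swap {n} {p} _) ⟨
    ‖ A ‖F² * ‖ X ‖F² ∎
    where open ≤-Reasoning

  module FrobeniusBounded {d} {γ : Carrier} {A : Mat d d}
    (0<γ : 0# < γ) (A-sym : IsSymmetric A) (‖A‖F²≤γ² : ‖ A ‖F² ≤ γ * γ) where

    ‖A·X‖F²≤γ²‖X‖F² : ∀ {p} (X : Mat d p) → ‖ A · X ‖F² ≤ (γ * γ) * ‖ X ‖F²
    ‖A·X‖F²≤γ²‖X‖F² X = ≤-trans (‖‖F²-submultiplicative A X)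
                                (*-monoʳ-≤-nonNeg (‖‖F²-nonNeg X) ‖A‖F²≤γ²)

    ⟪X,A·X⟫≤γ‖X‖F² : ∀ {p} (X : Mat d p) → ⟪ X , A · X ⟫ ≤ γ * ‖ X ‖F²
    ⟪X,A·X⟫≤γ‖X‖F² X = 0≤y-x⇒x≤y (0≤x+x⇒0≤x (0<x⇒0≤x*y⇒0≤y 0<γ (begin
      0#
        ≤⟨ ‖‖F²-nonNeg (λ i j → γ * X i j - (A · X) i j) ⟩
      ‖ (λ i j → γ * X i j - (A · X) i j) ‖F²
        ≈⟨ ‖xX-Z‖F² γ X (A · X) ⟩
      (γ * (γ * ‖X‖²) + ‖ A · X ‖F²) - (γ * xAx + γ * xAx)
        ≤⟨ +-monoˡ-≤ _ (+-monoʳ-≤ _ (‖A·X‖F²≤γ²‖X‖F² X)) ⟩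
      (γ * (γ * ‖X‖²) + (γ * γ) * ‖X‖²) - (γ * xAx + γ * xAx)
        ≈⟨ solve 3 (λ γ c a → (γ :* (γ :* c) :+ (γ :* γ) :* c) :- (γ :* a :+ γ :* a)
                              := γ :* ((γ :* c :- a) :+ (γ :* c :- a))) refl γ ‖X‖² xAx ⟩
      γ * ((γ * ‖X‖² - xAx) + (γ * ‖X‖² - xAx)) ∎)))
      where
      open ≤-Reasoning
      ‖X‖² xAx : Carrier
      ‖X‖² = ‖ X ‖F²
      xAx = ⟪ X , A · X ⟫

    ⟪X,Aʲ·X⟫≤γʲ‖X‖F² : ∀ j {p} (X : Mat d p) → ⟪ X , (A ^ᴹ j) · X ⟫ ≤ γ ^ j * ‖ X ‖F²
    ⟪X,Aʲ·X⟫≤γʲ‖X‖F² zero X = ≤-reflexive (begin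
      ⟪ X , I · X ⟫   ≈⟨ ⟪⟫-congʳ X (·-identityˡ X) ⟩
      ‖ X ‖F²         ≈⟨ *-identityˡ _ ⟨
      1# * ‖ X ‖F²    ∎)
      where open ≈-Reasoning
    ⟪X,Aʲ·X⟫≤γʲ‖X‖F² (suc zero) X = begin
      ⟪ X , (A · I) · X ⟫   ≈⟨ ⟪⟫-congʳ X (·-cong (·-identityʳ A) ≈ᴹ-refl) ⟩
      ⟪ X , A · X ⟫         ≤⟨ ⟪X,A·X⟫≤γ‖X‖F² X ⟩
      γ * ‖ X ‖F²           ≈⟨ *-congʳ (*-identityʳ γ) ⟨
      (γ * 1#) * ‖ X ‖F²    ∎
      where open ≤-Reasoning
    ⟪X,Aʲ·X⟫≤γʲ‖X‖F² (suc (suc j)) X = begin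
      ⟪ X , (A ^ᴹ (2 ℕ.+ j)) · X ⟫
        ≈⟨ ⟪⟫-congʳ X shift ⟩
      ⟪ X , A · (Aʲ · (A · X)) ⟫
        ≈⟨ trans (·-adjoint A X _) (⟪⟫-congˡ (Aʲ · (A · X)) (·-cong A-sym (≈ᴹ-refl {A = X}))) ⟩
      ⟪ A · X , Aʲ · (A · X) ⟫
        ≤⟨ ⟪X,Aʲ·X⟫≤γʲ‖X‖F² j (A · X) ⟩
      γ ^ j * ‖ A · X ‖F²
        ≤⟨ *-monoˡ-≤-nonNeg (^-nonNeg (proj₁ 0<γ) j) (‖A·X‖F²≤γ²‖X‖F² X) ⟩
      γ ^ j * ((γ * γ) * ‖ X ‖F²)
        ≈⟨ solve 3 (λ γ γʲ c → γʲ :* ((γ :* γ) :* c) := (γ :* (γ :* γʲ)) :* c)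
             refl γ (γ ^ j) ‖ X ‖F² ⟩
      γ ^ (2 ℕ.+ j) * ‖ X ‖F² ∎
      where
      open ≤-Reasoning
      Aʲ : Mat d d
      Aʲ = A ^ᴹ j
      shift : ((A ^ᴹ (2 ℕ.+ j)) · X) ≈ᴹ (A · (Aʲ · (A · X)))
      shift = ≈ᴹ-trans (·-assoc A (A · Aʲ) X) (·-cong ≈ᴹ-refl
                (≈ᴹ-trans (·-cong (^ᴹ-comm A j) ≈ᴹ-refl) (·-assoc Aʲ A X)))

    Tr-A²⁺ʲ≤γʲ‖A‖F² : ∀ j → Tr (A ^ᴹ (2 ℕ.+ j)) ≤ γ ^ j * ‖ A ‖F²
    Tr-A²⁺ʲ≤γʲ‖A‖F² j = begin
      Tr (A · (A ^ᴹ suc j))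
        ≈⟨ Tr-· A (A ^ᴹ suc j) ⟩
      ⟪ A , transpose (A ^ᴹ suc j) ⟫
        ≈⟨ ⟪⟫-congʳ A (≈ᴹ-trans (^ᴹ-symmetric A-sym (suc j)) (^ᴹ-comm A j)) ⟩
      ⟪ A , (A ^ᴹ j) · A ⟫
        ≤⟨ ⟪X,Aʲ·X⟫≤γʲ‖X‖F² j A ⟩
      γ ^ j * ‖ A ‖F² ∎
      where open ≤-Reasoning

-- Only the Frobenius bound of 𝓔(γ) and the symmetry of I − M are needed.
lemma2 : ∀ {c ℓ₁ ℓ₂ : Level} (F : OrderedField c ℓ₁ ℓ₂) →
    let open OrderedField F
        open Matrices F
    in ∀ {n d B : ℕ} (γ : Carrier) (U : Mat n d) (S : Mat B n) →
       (0# < γ) → (γ < 1#) →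
       OrthonormalColumns U →
       InE γ U S →
       ∀ (k : ℕ) → 2 ≤ℕ k →
       Tr ((I ⊖ sketchGram U S) ^ᴹ k) ≤ ((γ ^ (k ∸ 2)) * ‖ I ⊖ sketchGram U S ‖F²)
lemma2 F γ U S 0<γ _ _ (_ , ‖I-M‖F²≤γ² , _) (suc (suc j)) (s≤s (s≤s z≤n)) =
  FrobeniusBounded.Tr-A²⁺ʲ≤γʲ‖A‖F² 0<γ I⊖M-symmetric ‖I-M‖F²≤γ² j
  where
  open Properties F
  open Matrices F using (I; _⊖_; sketchGram)
  I⊖M-symmetric : IsSymmetric (I ⊖ sketchGram U S)
  I⊖M-symmetric = ⊖-symmetric δ-sym (sketchGram-symmetric U S)
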